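{- Let $\mathcal{C}$ be a path category. For any morphism $f\colon X\to Y$ in $\mathcal{C}$, the map $\mathrm{Path}\,f\colon\mathrm{Path}\,X\to\mathrm{Path}\,Y$ is a tree morphism, i.e. for every $m\in\mathrm{Path}\,X$ its restriction is a bijection from ${\downarrow}m=\{m'\in\mathrm{Path}\,X\mid m'\le m\}$ onto ${\downarrow}\mathrm{Path}\,f(m)\subseteq \mathrm{Path}\,Y$.
   Context: All categories are locally small and well-powered. Given morphisms $e,m$, say $e$ has the left lifting property with respect to $m$ if for every commutative square $v\circ e=m\circ u$ there is $d$ with $d\circ e=u$ and $m\circ d=v$. A weak factorisation system on a category is a pair $(\mathcal{Q},\mathcal{M})$ of classes of morphisms such that every morphism factors as $m\circ e$ with $e\in\mathcal{Q}$, $m\in\mathcal{M}$, $\mathcal{Q}$ is exactly the class of morphisms with the left lifting property with respect to all of $\mathcal{M}$, and $\mathcal{M}$ exactly the class with the right lifting property with respect to all of $\mathcal{Q}$. It is proper if morphisms of $\mathcal{Q}$ are epi and those of $\mathcal{M}$ are mono; stable if moreover for any $e\in\mathcal{Q}$, $m\in\mathcal{M}$ with common codomain the pullback of $e$ along $m$ exists and lies in $\mathcal{Q}$. Morphisms in $\mathcal{M}$ are embeddings, those in $\mathcal{Q}$ quotients. $\mathrm{Emb}\,X$ is the set of embeddings into $X$ modulo $m\sim n$ iff $m=n\circ i$ for an isomorphism $i$, ordered by $m\le n$ iff $m=n\circ i$ for some morphism $i$. For $f\colon X\to Y$ and an embedding $m\colon S\to X$, $\exists_f m\in\mathrm{Emb}\,Y$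 is the embedding part of the (quotient, embedding) factorisation of $f\circ m$. An object $P$ is a path if $\mathrm{Emb}\,P$ is a finite chain. A path embedding is an embedding whose domain is a path; $\mathrm{Path}\,X\subseteq\mathrm{Emb}\,X$ is the subposet of path embeddings, and $\mathrm{Path}\,f$ sends $m$ to $\exists_f m$. An object $X$ is connected if for every non-empty small family of paths $\{P_i\}$ every morphism $X\to\coprod_i P_i$ factors through some coproduct injection. A path category is a category with a stable proper factorisation system such that: (i) it has coproducts of all small families of paths; (ii) every path is connected; (iii) for paths $P,Q,R$ and $f\colon P\to Q$, $g\colon Q\to R$, if $g\circ f$ is a quotient then so is $f$. A tree morphism is a monotone map $\varphi$ between trees (posets in which every principal down-set is a finite chain and there is at most one minimal element) such that for every $u$ its restriction is a bijection ${\downarrow}u\to{\downarrow}\varphi(u)$. -}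

module Defs where

open import Level using (Level; _⊔_) renaming (suc to lsuc)
open import Data.Nat using (ℕ)
open import Data.Fin using (Fin)
open import Data.Product using (Σ; _×_; _,_; proj₁; proj₂)
open import Data.Sum using (_⊎_)
open import Function.Bundles using (_⇔_)
open import Relation.Binary.PropositionalEquality using (_≡_)

record Category (o ℓ : Level) : Set (lsuc (o ⊔ ℓ)) where
  infixr 9 _∘_
  field
    Obj   : Set o
    Hom   : Obj → Obj → Set ℓ
    id    : ∀ {A} → Hom A A
    _∘_   : ∀ {A B C} → Hom B C → Hom A B → Hom A C
    idˡ   : ∀ {A B} (f : Hom A B) → id ∘ f ≡ f
    idʳ   : ∀ {A B} (f : Hom A B) → f ∘ id ≡ f
    assoc : ∀ {A B C D} (h : Hom C D) (g : Hom B C) (f : Hom A B) →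
            (h ∘ g) ∘ f ≡ h ∘ (g ∘ f)

module Basics {o ℓ : Level} (C : Category o ℓ) where
  open Category C

  IsIso : ∀ {A B} → Hom A B → Set ℓ
  IsIso {A} {B} f = Σ (Hom B A) λ g → (g ∘ f ≡ id) × (f ∘ g ≡ id)

  Epi : ∀ {A B} → Hom A B → Set (o ⊔ ℓ)
  Epi {A} {B} f = ∀ {Z} (g h : Hom B Z) → g ∘ f ≡ h ∘ f → g ≡ h

  Mono : ∀ {A B} → Hom A B → Set (o ⊔ ℓ)
  Mono {A} {B} f = ∀ {Z} (g h : Hom Z A) → f ∘ g ≡ f ∘ h → g ≡ h

  LLP : ∀ {A B C D} → Hom A B → Hom C D → Set ℓ
  LLP {A} {B} {C} {D} e m =
    (u : Hom A C) (v : Hom B D) → v ∘ e ≡ m ∘ u →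
    Σ (Hom B C) λ d → (d ∘ e ≡ u) × (m ∘ d ≡ v)

  MorClass : (p : Level) → Set (o ⊔ ℓ ⊔ lsuc p)
  MorClass p = ∀ {A B} → Hom A B → Set p

  record IsPullback {A B Z : Obj} (f : Hom A Z) (g : Hom B Z)
                    {P : Obj} (p₁ : Hom P A) (p₂ : Hom P B) : Set (o ⊔ ℓ) where
    field
      commute   : f ∘ p₁ ≡ g ∘ p₂
      universal : ∀ {W} (h₁ : Hom W A) (h₂ : Hom W B) → f ∘ h₁ ≡ g ∘ h₂ →
                  Σ (Hom W P) λ u → (p₁ ∘ u ≡ h₁) × (p₂ ∘ u ≡ h₂) ×
                    (∀ (u' : Hom W P) → p₁ ∘ u' ≡ h₁ → p₂ ∘ u' ≡ h₂ → u' ≡ u)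

  record IsCoproduct {ι : Level} {I : Set ι} (P : I → Obj) (S : Obj)
                     (inj : (i : I) → Hom (P i) S) : Set (o ⊔ ℓ ⊔ ι) where
    field
      universal : ∀ {Z} (h : (i : I) → Hom (P i) Z) →
                  Σ (Hom S Z) λ u → (∀ i → u ∘ inj i ≡ h i) ×
                    (∀ (u' : Hom S Z) → (∀ i → u' ∘ inj i ≡ h i) → u' ≡ u)

  record FactorisationSystem (p : Level) : Set (o ⊔ ℓ ⊔ lsuc p) where
    field
      Q : MorClass p
      M : MorClass p
      factor : ∀ {A B} (f : Hom A B) →
               Σ Obj λ Z → Σ (Hom A Z) λ e → Σ (Hom Z B) λ m →
                 Q e × M m × (f ≡ m ∘ e)
      Q-is-LLP : ∀ {A B} (e : Hom A B) →
                 Q e ⇔ (∀ {X Y} (m : Hom X Y) → M m → LLP e m)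
      M-is-RLP : ∀ {X Y} (m : Hom X Y) →
                 M m ⇔ (∀ {A B} (e : Hom A B) → Q e → LLP e m)

  module WithFS {p : Level} (F : FactorisationSystem p) where
    open FactorisationSystem F

    IsProper : Set (o ⊔ ℓ ⊔ p)
    IsProper = (∀ {A B} (e : Hom A B) → Q e → Epi e) ×
               (∀ {A B} (m : Hom A B) → M m → Mono m)

    IsStable : Set (o ⊔ ℓ ⊔ p)
    IsStable = ∀ {A B Z} (e : Hom A Z) (m : Hom B Z) → Q e → M m →
               Σ Obj λ P → Σ (Hom P A) λ p₁ → Σ (Hom P B) λ p₂ →
                 IsPullback e m p₁ p₂ × Q p₂

    -- embeddings into X (representatives; Emb X is taken modulo _∼ₑ_)
    record Emb (X : Obj) : Set (o ⊔ ℓ ⊔ p) where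
      constructor emb
      field
        dom : Obj
        arr : Hom dom X
        isM : M arr
    open Emb public

    _≤ₑ_ : ∀ {X} → Emb X → Emb X → Set ℓ
    m ≤ₑ n = Σ (Hom (dom m) (dom n)) λ i → arr m ≡ arr n ∘ i

    _∼ₑ_ : ∀ {X} → Emb X → Emb X → Set ℓ
    m ∼ₑ n = Σ (Hom (dom m) (dom n)) λ i → IsIso i × (arr m ≡ arr n ∘ i)

    -- P is a path: Emb P (mod ∼ₑ) is a finite chain
    IsPath : Obj → Set (o ⊔ ℓ ⊔ p)
    IsPath P = (∀ (a b : Emb P) → (a ≤ₑ b) ⊎ (b ≤ₑ a)) ×
               Σ ℕ λ n → Σ (Fin n → Emb P) λ v →
                 ∀ (a : Emb P) → Σ (Fin n) λ k → a ∼ₑ v k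

    PathEmb : Obj → Set (o ⊔ ℓ ⊔ p)
    PathEmb X = Σ (Emb X) λ m → IsPath (dom m)

    ∃[_] : ∀ {X Y} → Hom X Y → Emb X → Emb Y
    ∃[ f ] m with factor (f ∘ arr m)
    ... | Z , e , m' , _ , Mm' , _ = emb Z m' Mm'

    Connected : (ι : Level) → Obj → Set (o ⊔ ℓ ⊔ p ⊔ lsuc ι)
    Connected ι X =
      ∀ {I : Set ι} → I → (P : I → Obj) → (∀ i → IsPath (P i)) →
      ∀ (S : Obj) (inj : (i : I) → Hom (P i) S) → IsCoproduct P S inj →
      (h : Hom X S) → Σ I λ i → Σ (Hom X (P i)) λ g → h ≡ inj i ∘ g

    PathMapIsTreeMorphism : ∀ {X Y} → Hom X Y → Set (o ⊔ ℓ ⊔ p)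
    PathMapIsTreeMorphism {X} {Y} f =
      (∀ (m : PathEmb X) → IsPath (dom (∃[ f ] (proj₁ m)))) ×
      (∀ (m m' : PathEmb X) → proj₁ m ∼ₑ proj₁ m' →
         ∃[ f ] (proj₁ m) ∼ₑ ∃[ f ] (proj₁ m')) ×
      (∀ (m m' : PathEmb X) → proj₁ m ≤ₑ proj₁ m' →
         ∃[ f ] (proj₁ m) ≤ₑ ∃[ f ] (proj₁ m')) ×
      (∀ (m m₁ m₂ : PathEmb X) → proj₁ m₁ ≤ₑ proj₁ m → proj₁ m₂ ≤ₑ proj₁ m →
         ∃[ f ] (proj₁ m₁) ∼ₑ ∃[ f ] (proj₁ m₂) → proj₁ m₁ ∼ₑ proj₁ m₂) ×
      (∀ (m : PathEmb X) (n : PathEmb Y) → proj₁ n ≤ₑ ∃[ f ] (proj₁ m) →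
         Σ (PathEmb X) λ m' → (proj₁ m' ≤ₑ proj₁ m) × (∃[ f ] (proj₁ m') ∼ₑ proj₁ n))

  -- Path category; ι is the universe level of "small" index families
  record PathCategory (p ι : Level) : Set (o ⊔ ℓ ⊔ lsuc p ⊔ lsuc ι) where
    field
      fs      : FactorisationSystem p
      proper  : WithFS.IsProper fs
      stable  : WithFS.IsStable fs
      coproducts : ∀ {I : Set ι} (P : I → Obj) → (∀ i → WithFS.IsPath fs (P i)) →
                   Σ Obj λ S → Σ ((i : I) → Hom (P i) S) λ inj → IsCoproduct P S inj
      paths-connected : ∀ (P : Obj) → WithFS.IsPath fs P → WithFS.Connected fs ι P
      quotient-cancel : ∀ {P Q R} → WithFS.IsPath fs P → WithFS.IsPath fs Q →
                        WithFS.IsPath fs R → (f : Hom P Q) (g : Hom Q R) →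
                        FactorisationSystem.Q fs (g ∘ f) → FactorisationSystem.Q fs f

-- The image ∃_f m of a path embedding is a path: by stability, ∃_e along a quotient e
-- is essentially surjective on embeddings, so Emb (dom ∃_f m) is a monotone image of
-- the finite chain Emb (dom m).  Monotonicity of ∃_f is a single lift.  For injectivity
-- on ↓m, two embeddings m₁, m₂ below the path m are comparable, say m₁ = m₂ ∘ i, so i is
-- an embedding; if ∃_f m₁ ≅ ∃_f m₂ via j, then with quotient parts e₁, e₂ we get
-- e₂ ∘ i = j ∘ e₁, a quotient, so i is a quotient by axiom (iii) and hence an iso.  For
-- surjectivity onto ↓(∃_f m), pull the quotient part of f ∘ m back along the given
-- embedding; the resulting subobject of the path dom m is again a path.

module Submission where

open import Level using (Level; _⊔_)
open import Data.Nat using (ℕ)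
open import Data.Fin using (Fin)
open import Data.Product using (Σ; _×_; _,_; proj₁; proj₂)
import Data.Product as Product
open import Data.Sum using (_⊎_; inj₁; inj₂)
import Data.Sum as Sum
open import Function.Bundles using (Equivalence)
open import Relation.Binary.Bundles using (Preorder)
open import Relation.Binary.PropositionalEquality
  using (_≡_; refl; sym; trans; cong; subst; module ≡-Reasoning)
import Relation.Binary.Reasoning.Preorder as PreorderReasoning
open import Defs

module MorphismReasoning {o ℓ : Level} (C : Category o ℓ) where
  open Category C

  private variable
    A B : Obj
    a b c d f : Hom A B

  pullˡ : a ∘ b ≡ c → a ∘ (b ∘ f) ≡ c ∘ f
  pullˡ {a = a} {b = b} {f = f} ab≡c = trans (sym (assoc a b f)) (cong (_∘ f) ab≡c)

  pullʳ : b ∘ f ≡ c → (a ∘ b) ∘ f ≡ a ∘ c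
  pullʳ {b = b} {f = f} {a = a} bf≡c = trans (assoc a b f) (cong (a ∘_) bf≡c)

  pushˡ : c ≡ a ∘ b → c ∘ f ≡ a ∘ (b ∘ f)
  pushˡ c≡ab = sym (pullˡ (sym c≡ab))

  extendʳ : a ∘ b ≡ c ∘ d → a ∘ (b ∘ f) ≡ c ∘ (d ∘ f)
  extendʳ {c = c} {d = d} {f = f} ab≡cd = trans (pullˡ ab≡cd) (assoc c d f)

  cancelˡ : a ∘ b ≡ id → a ∘ (b ∘ f) ≡ f
  cancelˡ {f = f} ab≡id = trans (pullˡ ab≡id) (idˡ f)

  cancelʳ : a ∘ b ≡ id → (f ∘ a) ∘ b ≡ f
  cancelʳ {f = f} ab≡id = trans (pullʳ ab≡id) (idʳ f)

module FactorisationSystemProperties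
    {o ℓ p : Level} {C : Category o ℓ} (F : Basics.FactorisationSystem C p) where
  open Category C
  open Basics C
  open FactorisationSystem F
  open WithFS F
  open MorphismReasoning C

  private variable
    A B X Y : Obj
    e i j m u : Hom A B

  lift : Q e → M m → LLP e m
  lift {e = e} {m = m} Qe Mm = Equivalence.to (M-is-RLP m) Mm e Qe

  Q-intro : (∀ {X Y} (m : Hom X Y) → M m → LLP e m) → Q e
  Q-intro {e = e} = Equivalence.from (Q-is-LLP e)

  M-intro : (∀ {A B} (e : Hom A B) → Q e → LLP e m) → M m
  M-intro {m = m} = Equivalence.from (M-is-RLP m)

  M-id : M (id {A})
  M-id = M-intro λ e Qe u v ve≡u → v , trans ve≡u (idˡ u) , idˡ v

  M-∘ : M m → M u → M (u ∘ m)
  M-∘ {m = m} {u = u} Mm Mu = M-intro λ e Qe x y ye≡umx →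
    let d₁ , d₁e≡mx , ud₁≡y = lift Qe Mu (m ∘ x) y (trans ye≡umx (assoc u m x))
        d , de≡x , md≡d₁ = lift Qe Mm x d₁ d₁e≡mx
    in d , de≡x , trans (pullʳ md≡d₁) ud₁≡y

  Q-∘ : Q e → Q u → Q (u ∘ e)
  Q-∘ {e = e} {u = u} Qe Qu = Q-intro λ m Mm x y yue≡mx →
    let d₁ , d₁e≡x , md₁≡yu = lift Qe Mm x (y ∘ u) (trans (assoc y u e) yue≡mx)
        d , du≡d₁ , md≡y = lift Qu Mm d₁ y (sym md₁≡yu)
    in d , trans (pullˡ du≡d₁) d₁e≡x , md≡y

  IsIso⇒Q : IsIso i → Q i
  IsIso⇒Q {i = i} (j , ji≡id , ij≡id) = Q-intro λ m Mm x y yi≡mx →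
    x ∘ j , cancelʳ ji≡id ,
    trans (sym (assoc m x j)) (trans (cong (_∘ j) (sym yi≡mx)) (cancelʳ ij≡id))

  Q×M⇒IsIso : Q e → M e → IsIso e
  Q×M⇒IsIso {e = e} Qe Me =
    let d , de≡id , ed≡id = lift Qe Me id id (trans (idˡ e) (sym (idʳ e)))
    in d , de≡id , ed≡id

  module _ {Z P : Obj} {e : Hom A Z} {m : Hom B Z} {p₁ : Hom P A} {p₂ : Hom P B}
           (pb : IsPullback e m p₁ p₂) where
    open IsPullback pb

    pullback-jointly-mono : ∀ {W} {x y : Hom W P} →
                            p₁ ∘ x ≡ p₁ ∘ y → p₂ ∘ x ≡ p₂ ∘ y → x ≡ y
    pullback-jointly-mono {x = x} {y} p₁x≡p₁y p₂x≡p₂y =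
      let _ , _ , _ , unique = universal (p₁ ∘ y) (p₂ ∘ y) (extendʳ commute)
      in trans (unique x p₁x≡p₁y p₂x≡p₂y) (sym (unique y refl refl))

    M-pullback : M m → M p₁
    M-pullback Mm = M-intro λ e' Qe' x y ye'≡p₁x →
      let sq : e ∘ (y ∘ e') ≡ m ∘ (p₂ ∘ x)
          sq = trans (cong (e ∘_) ye'≡p₁x) (extendʳ commute)
          d , de'≡p₂x , md≡ey = lift Qe' Mm (p₂ ∘ x) (e ∘ y) (trans (assoc e y e') sq)
          w , p₁w≡y , p₂w≡d , _ = universal y d (sym md≡ey)
      in w , pullback-jointly-mono (trans (pullˡ p₁w≡y) ye'≡p₁x) (trans (pullˡ p₂w≡d) de'≡p₂x)
           , p₁w≡y

  IsIso-∘ : IsIso i → IsIso u → IsIso (u ∘ i)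
  IsIso-∘ {i = i} {u = u} (i⁻¹ , i⁻¹i≡id , ii⁻¹≡id) (u⁻¹ , u⁻¹u≡id , uu⁻¹≡id) =
    i⁻¹ ∘ u⁻¹ ,
    trans (pullʳ (cancelˡ u⁻¹u≡id)) i⁻¹i≡id ,
    trans (pullʳ (cancelˡ ii⁻¹≡id)) uu⁻¹≡id

  IsIso-id : IsIso (id {A})
  IsIso-id = id , idˡ id , idˡ id

  -- Copies of _≤ₑ_ and _∼ₑ_ as records: the originals reduce to Σ-types, from
  -- which Agda cannot infer the two embeddings.
  record _≤_ {X : Obj} (a b : Emb X) : Set ℓ where
    constructor _,_
    field
      witness  : Hom (dom a) (dom b)
      commutes : arr a ≡ arr b ∘ witness

  record _∼_ {X : Obj} (a b : Emb X) : Set ℓ where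
    constructor _,_
    field
      witness      : Hom (dom a) (dom b)
      iso-commutes : IsIso witness × (arr a ≡ arr b ∘ witness)

  ≤ₑ⇒≤ : {a b : Emb X} → a ≤ₑ b → a ≤ b
  ≤ₑ⇒≤ (i , a≡bi) = i , a≡bi

  ≤⇒≤ₑ : {a b : Emb X} → a ≤ b → a ≤ₑ b
  ≤⇒≤ₑ (i , a≡bi) = i , a≡bi

  ∼ₑ⇒∼ : {a b : Emb X} → a ∼ₑ b → a ∼ b
  ∼ₑ⇒∼ (i , i-iso-commutes) = i , i-iso-commutes

  ∼⇒∼ₑ : {a b : Emb X} → a ∼ b → a ∼ₑ b
  ∼⇒∼ₑ (i , i-iso-commutes) = i , i-iso-commutes

  ∼-refl : {a : Emb X} → a ∼ a
  ∼-refl {a = a} = id , IsIso-id , sym (idʳ (arr a))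

  ∼-sym : {a b : Emb X} → a ∼ b → b ∼ a
  ∼-sym {a = a} {b} (i , (j , ji≡id , ij≡id) , a≡bi) =
    j , (i , ij≡id , ji≡id) , sym (trans (cong (_∘ j) a≡bi) (cancelʳ ij≡id))

  ∼-trans : {a b c : Emb X} → a ∼ b → b ∼ c → a ∼ c
  ∼-trans {c = c} (i , i-iso , a≡bi) (j , j-iso , b≡cj) =
    j ∘ i , IsIso-∘ i-iso j-iso , trans a≡bi (trans (cong (_∘ i) b≡cj) (assoc (arr c) j i))

  ∼⇒≤ : {a b : Emb X} → a ∼ b → a ≤ b
  ∼⇒≤ (i , _ , a≡bi) = i , a≡bi

  ≤-trans : {a b c : Emb X} → a ≤ b → b ≤ c → a ≤ c
  ≤-trans {c = c} (i , a≡bi) (j , b≡cj) =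
    j ∘ i , trans a≡bi (trans (cong (_∘ i) b≡cj) (assoc (arr c) j i))

  Emb-preorder : Obj → Preorder (o ⊔ ℓ ⊔ p) ℓ ℓ
  Emb-preorder X = record
    { Carrier    = Emb X
    ; _≈_        = _∼_
    ; _≲_        = _≤_
    ; isPreorder = record
      { isEquivalence = record { refl = ∼-refl ; sym = ∼-sym ; trans = ∼-trans }
      ; reflexive     = ∼⇒≤
      ; trans         = ≤-trans
      }
    }

  IsPath-intro : (∀ a b → (a ≤ b) ⊎ (b ≤ a)) → (n : ℕ) (v : Fin n → Emb X) →
                 (∀ a → Σ (Fin n) λ k → a ∼ v k) → IsPath X
  IsPath-intro total n v covers =
    (λ a b → Sum.map ≤⇒≤ₑ ≤⇒≤ₑ (total a b)) , n , v , λ a → Product.map₂ ∼⇒∼ₑ (covers a)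

  IsPath-≤-total : IsPath X → (a b : Emb X) → (a ≤ b) ⊎ (b ≤ a)
  IsPath-≤-total (total , _) a b = Sum.map ≤ₑ⇒≤ ≤ₑ⇒≤ (total a b)

  ∃-factor : (f : Hom X Y) (a : Emb X) →
             Σ (Hom (dom a) (dom (∃[ f ] a))) λ e → Q e × (f ∘ arr a ≡ arr (∃[ f ] a) ∘ e)
  ∃-factor f a with factor (f ∘ arr a)
  ... | _ , e , _ , Qe , _ , fa≡me = e , Qe , fa≡me

  ≤-of-quotient-square : {a b : Emb X} {e : Hom A (dom a)} {u : Hom A (dom b)} →
                         Q e → arr a ∘ e ≡ arr b ∘ u → a ≤ b
  ≤-of-quotient-square {a = a} {b} {u = u} Qe ae≡bu =
    let d , _ , bd≡a = lift Qe (isM b) u (arr a) ae≡bu in d , sym bd≡a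

  ∃-mono : (f : Hom X Y) {a a' : Emb X} → a ≤ a' → ∃[ f ] a ≤ ∃[ f ] a'
  ∃-mono f {a} {a'} (i , a≡a'i) =
    let e , Qe , fa≡ne = ∃-factor f a
        e' , _ , fa'≡n'e' = ∃-factor f a'
        open ≡-Reasoning
    in ≤-of-quotient-square Qe (begin
         arr (∃[ f ] a) ∘ e      ≡⟨ sym fa≡ne ⟩
         f ∘ arr a               ≡⟨ cong (f ∘_) a≡a'i ⟩
         f ∘ (arr a' ∘ i)        ≡⟨ extendʳ fa'≡n'e' ⟩
         arr (∃[ f ] a') ∘ e' ∘ i ∎)

  module Proper (proper : IsProper) where

    mono : M m → Mono m
    mono {m = m} = proj₂ proper m

    M-cancelʳ : M m → M (m ∘ i) → M i
    M-cancelʳ {m = m} {i = i} Mm Mmi = M-intro λ e Qe x y ye≡ix →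
      let d , de≡x , mid≡my = lift Qe Mmi x (m ∘ y) (trans (pullʳ ye≡ix) (sym (assoc m i x)))
      in d , de≡x , mono Mm (i ∘ d) y (trans (sym (assoc m i d)) mid≡my)

    mutual-factors-retraction : M m → m ≡ u ∘ i → u ≡ m ∘ j → j ∘ i ≡ id
    mutual-factors-retraction {m = m} {u = u} {i = i} {j = j} Mm m≡ui u≡mj =
      mono Mm (j ∘ i) id (trans (pullˡ (sym u≡mj)) (trans (sym m≡ui) (sym (idʳ m))))

    ≤-witness-M : {a b : Emb X} ((i , _) : a ≤ b) → M i
    ≤-witness-M {a = a} {b} (i , a≡bi) = M-cancelʳ (isM b) (subst M a≡bi (isM a))

    ≤-antisym : {a b : Emb X} → a ≤ b → b ≤ a → a ∼ b
    ≤-antisym {a = a} {b} (i , a≡bi) (j , b≡aj) =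
      i , (j , mutual-factors-retraction (isM a) a≡bi b≡aj ,
               mutual-factors-retraction (isM b) b≡aj a≡bi) , a≡bi

    monotone-resp-∼ : (φ : Emb X → Emb Y) → (∀ {a a'} → a ≤ a' → φ a ≤ φ a') →
                      ∀ {a a'} → a ∼ a' → φ a ∼ φ a'
    monotone-resp-∼ φ φ-mono a∼a' =
      ≤-antisym (φ-mono (∼⇒≤ a∼a')) (φ-mono (∼⇒≤ (∼-sym a∼a')))

    ∃-resp-∼ : (f : Hom X Y) {a a' : Emb X} → a ∼ a' → ∃[ f ] a ∼ ∃[ f ] a'
    ∃-resp-∼ f = monotone-resp-∼ ∃[ f ] (∃-mono f)

    ∃-unique : (f : Hom X Y) (a : Emb X) (b : Emb Y) {e : Hom (dom a) (dom b)} →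
               Q e → f ∘ arr a ≡ arr b ∘ e → ∃[ f ] a ∼ b
    ∃-unique f a b Qe fa≡be =
      let e' , Qe' , fa≡ne' = ∃-factor f a
      in ≤-antisym (≤-of-quotient-square Qe' (trans (sym fa≡ne') fa≡be))
                   (≤-of-quotient-square Qe (trans (sym fa≡be) fa≡ne'))

    path-image : (φ : Emb X → Emb Y) → (∀ {a a'} → a ≤ a' → φ a ≤ φ a') →
                 (∀ b → Σ (Emb X) λ a → φ a ∼ b) → IsPath X → IsPath Y
    path-image {Y = Y} φ φ-mono φ-surj path@(_ , n , v , v-covers) =
      IsPath-intro total' n (λ k → φ (v k)) covers'
      where
        open PreorderReasoning (Emb-preorder Y)

        total' : ∀ b₁ b₂ → (b₁ ≤ b₂) ⊎ (b₂ ≤ b₁)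
        total' b₁ b₂ with φ-surj b₁ | φ-surj b₂
        ... | a₁ , φa₁∼b₁ | a₂ , φa₂∼b₂ with IsPath-≤-total path a₁ a₂
        ... | inj₁ a₁≤a₂ = inj₁ (begin b₁ ≈⟨ φa₁∼b₁ ⟨ φ a₁ ≲⟨ φ-mono a₁≤a₂ ⟩ φ a₂ ≈⟨ φa₂∼b₂ ⟩ b₂ ∎)
        ... | inj₂ a₂≤a₁ = inj₂ (begin b₂ ≈⟨ φa₂∼b₂ ⟨ φ a₂ ≲⟨ φ-mono a₂≤a₁ ⟩ φ a₁ ≈⟨ φa₁∼b₁ ⟩ b₁ ∎)

        covers' : ∀ b → Σ (Fin n) λ k → b ∼ φ (v k)
        covers' b =
          let a , φa∼b = φ-surj b
              k , a∼vk = v-covers a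
          in k , ∼-trans (∼-sym φa∼b) (monotone-resp-∼ φ φ-mono (∼ₑ⇒∼ a∼vk))

    module _ {P' P : Obj} {s : Hom P' P} (Ms : M s) where

      along : Emb P' → Emb P
      along a = emb (dom a) (s ∘ arr a) (M-∘ (isM a) Ms)

      whole : Emb P
      whole = emb P' s Ms

      along-mono : {a b : Emb P'} → a ≤ b → along a ≤ along b
      along-mono {b = b} (i , a≡bi) = i , trans (cong (s ∘_) a≡bi) (sym (assoc s (arr b) i))

      along-reflects-≤ : {a b : Emb P'} → along a ≤ along b → a ≤ b
      along-reflects-≤ {b = b} (i , sa≡sbi) = i , mono Ms _ _ (trans sa≡sbi (assoc s (arr b) i))

      along-reflects-∼ : {a b : Emb P'} → along a ∼ along b → a ∼ b
      along-reflects-∼ {b = b} (i , i-iso , sa≡sbi) =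
        i , i-iso , mono Ms _ _ (trans sa≡sbi (assoc s (arr b) i))

      along-≤-whole : (a : Emb P') → along a ≤ whole
      along-≤-whole a = arr a , refl

      -- Embeddings above s all restrict to the top element of Emb P'.
      restrict : (b : Emb P) → (b ≤ whole) ⊎ (whole ≤ b) → Emb P'
      restrict b (inj₁ b≤whole) = emb (dom b) (_≤_.witness b≤whole) (≤-witness-M b≤whole)
      restrict b (inj₂ _)       = emb P' id M-id

      along-restrict-below : {b : Emb P} (b≤whole : b ≤ whole) → b ∼ along (restrict b (inj₁ b≤whole))
      along-restrict-below (i , b≡si) = id , IsIso-id , trans b≡si (sym (idʳ (s ∘ i)))

      along-restrict : (a : Emb P') (b : Emb P) (cmp : (b ≤ whole) ⊎ (whole ≤ b)) →
                       along a ∼ b → along a ∼ along (restrict b cmp)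
      along-restrict a b (inj₁ b≤whole) sa∼b = ∼-trans sa∼b (along-restrict-below b≤whole)
      along-restrict a b (inj₂ whole≤b) sa∼b =
        ∼-trans (≤-antisym (along-≤-whole a) (≤-trans whole≤b (∼⇒≤ (∼-sym sa∼b))))
                (id , IsIso-id , sym (trans (idʳ (s ∘ id)) (idʳ s)))

      subobject-of-path : IsPath P → IsPath P'
      subobject-of-path path@(_ , n , v , v-covers) = IsPath-intro total' n w covers'
        where
          total' : ∀ a b → (a ≤ b) ⊎ (b ≤ a)
          total' a b = Sum.map along-reflects-≤ along-reflects-≤ (IsPath-≤-total path (along a) (along b))

          cmp : (k : Fin n) → (v k ≤ whole) ⊎ (whole ≤ v k)
          cmp k = IsPath-≤-total path (v k) whole

          w : Fin n → Emb P'
          w k = restrict (v k) (cmp k)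

          covers' : ∀ a → Σ (Fin n) λ k → a ∼ w k
          covers' a =
            let k , sa∼vk = v-covers (along a)
            in k , along-reflects-∼ (along-restrict a (v k) (cmp k) (∼ₑ⇒∼ sa∼vk))

    module Stable (stable : IsStable) where

      ∃-quotient-surjective : {e : Hom X Y} → Q e → (b : Emb Y) → Σ (Emb X) λ a → ∃[ e ] a ∼ b
      ∃-quotient-surjective {e = e} Qe b =
        let _ , p₁ , _ , pb , Qp₂ = stable e (arr b) Qe (isM b)
            a = emb _ p₁ (M-pullback pb (isM b))
        in a , ∃-unique e a b Qp₂ (IsPullback.commute pb)

      quotient-of-path : {e : Hom X Y} → Q e → IsPath X → IsPath Y
      quotient-of-path {e = e} Qe = path-image ∃[ e ] (∃-mono e) (∃-quotient-surjective Qe)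

module PathCategoryProperties {o ℓ p ι : Level} {C : Category o ℓ}
                              (PC : Basics.PathCategory C p ι) where
  open Category C
  open Basics C
  open PathCategory PC
  open FactorisationSystem fs
  open WithFS fs
  open MorphismReasoning C
  open FactorisationSystemProperties fs public
  open Proper proper public
  open Stable stable

  private variable
    X Y : Obj

  ∃-preserves-IsPath : (f : Hom X Y) (m : Emb X) → IsPath (dom m) → IsPath (dom (∃[ f ] m))
  ∃-preserves-IsPath f m = quotient-of-path (proj₁ (proj₂ (∃-factor f m)))

  ≤-total-below-path : {m m₁ m₂ : Emb X} → IsPath (dom m) → m₁ ≤ m → m₂ ≤ m →
                       (m₁ ≤ m₂) ⊎ (m₂ ≤ m₁)
  ≤-total-below-path {X = X} {m} {m₁} {m₂} path m₁≤m m₂≤m =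
    Sum.map (compare m₁≤m m₂≤m) (compare m₂≤m m₁≤m)
            (IsPath-≤-total path (below m₁ m₁≤m) (below m₂ m₂≤m))
    where
      open PreorderReasoning (Emb-preorder X)

      below : (b : Emb X) → b ≤ m → Emb (dom m)
      below b b≤m = restrict (isM m) b (inj₁ b≤m)

      compare : {b₁ b₂ : Emb X} (b₁≤m : b₁ ≤ m) (b₂≤m : b₂ ≤ m) →
                below b₁ b₁≤m ≤ below b₂ b₂≤m → b₁ ≤ b₂
      compare {b₁} {b₂} b₁≤m b₂≤m a₁≤a₂ = begin
        b₁                                 ≈⟨ along-restrict-below (isM m) b₁≤m ⟩
        along (isM m) (below b₁ b₁≤m)      ≲⟨ along-mono (isM m) a₁≤a₂ ⟩
        along (isM m) (below b₂ b₂≤m)      ≈⟨ along-restrict-below (isM m) b₂≤m ⟨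
        b₂                                 ∎

  ∃-reflects-∼-on-≤ : (f : Hom X Y) {m₁ m₂ : Emb X} → IsPath (dom m₁) → IsPath (dom m₂) →
                      m₁ ≤ m₂ → ∃[ f ] m₁ ∼ ∃[ f ] m₂ → m₁ ∼ m₂
  ∃-reflects-∼-on-≤ f {m₁} {m₂} path₁ path₂ m₁≤m₂@(i , m₁≡m₂i) (j , j-iso , n₁≡n₂j)
    with ∃-factor f m₁ | ∃-factor f m₂
  ... | e₁ , Qe₁ , fm₁≡n₁e₁ | e₂ , _ , fm₂≡n₂e₂ =
    i , Q×M⇒IsIso Qi (≤-witness-M m₁≤m₂) , m₁≡m₂i
    where
      open ≡-Reasoning
      n₁ = arr (∃[ f ] m₁)
      n₂ = arr (∃[ f ] m₂)

      e₂i≡je₁ : e₂ ∘ i ≡ j ∘ e₁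
      e₂i≡je₁ = mono (isM (∃[ f ] m₂)) _ _ (begin
        n₂ ∘ e₂ ∘ i      ≡⟨ pullˡ (sym fm₂≡n₂e₂) ⟩
        (f ∘ arr m₂) ∘ i ≡⟨ pullʳ (sym m₁≡m₂i) ⟩
        f ∘ arr m₁       ≡⟨ fm₁≡n₁e₁ ⟩
        n₁ ∘ e₁          ≡⟨ pushˡ n₁≡n₂j ⟩
        n₂ ∘ j ∘ e₁      ∎)

      Qi : Q i
      Qi = quotient-cancel path₁ path₂ (∃-preserves-IsPath f m₂ path₂) i e₂
             (subst Q (sym e₂i≡je₁) (Q-∘ Qe₁ (IsIso⇒Q j-iso)))

  ∃-injective-below-path : (f : Hom X Y) {m m₁ m₂ : Emb X} →
                           IsPath (dom m) → IsPath (dom m₁) → IsPath (dom m₂) →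
                           m₁ ≤ m → m₂ ≤ m → ∃[ f ] m₁ ∼ ∃[ f ] m₂ → m₁ ∼ m₂
  ∃-injective-below-path f path path₁ path₂ m₁≤m m₂≤m fm₁∼fm₂
    with ≤-total-below-path path m₁≤m m₂≤m
  ... | inj₁ m₁≤m₂ = ∃-reflects-∼-on-≤ f path₁ path₂ m₁≤m₂ fm₁∼fm₂
  ... | inj₂ m₂≤m₁ = ∼-sym (∃-reflects-∼-on-≤ f path₂ path₁ m₂≤m₁ (∼-sym fm₁∼fm₂))

  ∃-lifts-below-path : (f : Hom X Y) (m : Emb X) → IsPath (dom m) → (n : Emb Y) →
                       n ≤ ∃[ f ] m →
                       Σ (PathEmb X) λ m' → (proj₁ m' ≤ m) × (∃[ f ] (proj₁ m') ∼ n)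
  ∃-lifts-below-path f m path n n≤fm@(k , n≡n'k) =
    let e , Qe , fm≡n'e = ∃-factor f m
        Mk = ≤-witness-M n≤fm
        P' , p₁ , p₂ , pb , Qp₂ = stable e k Qe Mk
        Mp₁ = M-pullback pb Mk
        m' = emb P' (arr m ∘ p₁) (M-∘ Mp₁ (isM m))
    in (m' , subobject-of-path Mp₁ path) , (p₁ , refl) ,
       ∃-unique f m' n Qp₂
         (trans (pullˡ fm≡n'e) (trans (pullʳ (IsPullback.commute pb)) (pullˡ (sym n≡n'k))))

proposition3p12 : ∀ {o ℓ p ι : Level} (C : Category o ℓ) (PC : Basics.PathCategory C p ι)
                    {X Y : Category.Obj C} (f : Category.Hom C X Y) →
                    Basics.WithFS.PathMapIsTreeMorphism C (Basics.PathCategory.fs PC) f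
proposition3p12 C PC f =
    (λ (m , path) → ∃-preserves-IsPath f m path)
  , (λ (m , _) (m' , _) m∼m' → ∼⇒∼ₑ (∃-resp-∼ f {m} {m'} (∼ₑ⇒∼ m∼m')))
  , (λ (m , _) (m' , _) m≤m' → ≤⇒≤ₑ (∃-mono f {m} {m'} (≤ₑ⇒≤ m≤m')))
  , (λ (m , path) (m₁ , path₁) (m₂ , path₂) m₁≤m m₂≤m fm₁∼fm₂ →
       ∼⇒∼ₑ (∃-injective-below-path f {m} {m₁} {m₂} path path₁ path₂
               (≤ₑ⇒≤ m₁≤m) (≤ₑ⇒≤ m₂≤m) (∼ₑ⇒∼ fm₁∼fm₂)))
  , (λ (m , path) (n , _) n≤fm →
       let m' , m'≤m , fm'∼n = ∃-lifts-below-path f m path n (≤ₑ⇒≤ n≤fm)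
       in m' , ≤⇒≤ₑ m'≤m , ∼⇒∼ₑ fm'∼n)
  where open PathCategoryProperties PC
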